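{- Let $(S,\gamma,(L_x)_{x\in S},(\varphi_x^y)_{x\le_\gamma y})$ be a modular connected system with sum $L$. For any $a\in L$, the set $\Pi_a=\{x\in S: a\in\Lambda_x\}$ is a finite interval in $S$.
   Context: A lattice is l.f.f.c. if every closed interval is finite and every element has finitely many upper and lower covers. $x\lessdot y$ means $y$ covers $x$. A tolerance on a lattice $S$ is a reflexive, symmetric relation $\gamma$ with $a\,\gamma\,b$, $c\,\gamma\,d$ implying $(a\vee c)\,\gamma\,(b\vee d)$ and $(a\wedge c)\,\gamma\,(b\wedge d)$; $x\le_\gamma y$ means $x\le y$ and $x\,\gamma\,y$. A modular connected system $(S,\gamma,(L_x)_{x\in S},(\varphi_x^y)_{x\le_\gamma y})$ is a lattice $S$, a tolerance $\gamma$ on $S$, lattices $L_x$ and maps $\varphi_x^y$ satisfying: (MC1) $S$ is l.f.f.c.; (MC2) each $L_x$ is finite, modular, complemented; (MC3) each $\varphi_x^y$ is a lattice isomorphism from a nonempty lattice filter $F_x^y$ of $L_x$ onto a lattice ideal $I_x^y$ of $L_y$; (MC4) $F_x^x=I_x^x=L_x$, $\varphi_x^x=\mathrm{id}$; (MC5) if $x\le_\gamma y\le_\gamma z$ and $I_x^y\cap F_y^z\neq\emptyset$ then $x\,\gamma\,z$; (MC6) for $x\le z\le y$ with $x\,\gamma\,y$: $F_x^y=(\varphi_x^z)^{ -1}(I_x^z\cap F_z^y)$, $I_x^y=\varphi_z^y(I_x^z\cap F_z^y)$, $\varphi_x^y=\varphi_z^y\circ\varphi_x^z|_{F_x^y}$;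 (MC7) if $x\,\gamma\,y$ then $I_x^{x\vee y}\cap I_y^{x\vee y}\subseteq I_{x\wedge y}^{x\vee y}$ and $F_{x\wedge y}^x\cap F_{x\wedge y}^y\subseteq F_{x\wedge y}^{x\vee y}$; (MC8.1) $x\lessdot y$ implies $x\,\gamma\,y$; (MC8.2) $x\lessdot y$ implies $F_x^y\neq L_x$ and $I_x^y\neq L_y$. Sum: $M=\{(x,a):x\in S,a\in L_x\}$, $(x,a)\sim(y,b)$ iff $x\,\gamma\,y$, $a\in F_x^{x\vee y}$, $b\in F_y^{x\vee y}$, $\varphi_x^{x\vee y}(a)=\varphi_y^{x\vee y}(b)$ (an equivalence relation); $L=M/{\sim}$; $\pi_x(a)$ is the class of $(x,a)$ and $\Lambda_x=\pi_x(L_x)\subseteq L$. -}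

module Defs where

open import Level using (0ℓ)
open import Data.Product using (Σ; ∃; _×_; _,_; proj₁; proj₂)
open import Data.Sum using (_⊎_)
open import Data.List using (List)
open import Data.List.Membership.Propositional using (_∈_)
open import Relation.Nullary using (¬_)
open import Relation.Binary.Core using (Rel)
open import Relation.Binary.PropositionalEquality using (_≡_)
open import Relation.Binary.Lattice.Structures using (IsLattice)
open import Algebra.Core using (Op₂)
open import Function using (_⇔_)

module _ {A : Set} where

  SubFinite : (A → Set) → Set
  SubFinite P = Σ (List A) λ xs → ∀ a → P a → a ∈ xs

  FiniteCarrier : Set
  FiniteCarrier = Σ (List A) λ xs → ∀ a → a ∈ xs

module _ {A : Set} (_≤_ : Rel A 0ℓ) where

  _<_ : Rel A 0ℓ
  x < y = x ≤ y × ¬ (x ≡ y)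

  Covers : Rel A 0ℓ
  Covers x y = x < y × (∀ z → x ≤ z → z ≤ y → (z ≡ x) ⊎ (z ≡ y))

  LFFC : Set
  LFFC = (∀ x y → SubFinite (λ z → x ≤ z × z ≤ y))
       × (∀ x → SubFinite (λ y → Covers x y))
       × (∀ x → SubFinite (λ y → Covers y x))

module _ {A : Set} (_≤_ : Rel A 0ℓ) (_∨_ _∧_ : Op₂ A) where

  IsModular : Set
  IsModular = ∀ a b c → a ≤ c → (a ∨ (b ∧ c)) ≡ ((a ∨ b) ∧ c)

  IsComplemented : Set
  IsComplemented = Σ A λ bot → Σ A λ top →
    (∀ a → bot ≤ a) × (∀ a → a ≤ top) ×
    (∀ a → Σ A λ b → ((a ∨ b) ≡ top) × ((a ∧ b) ≡ bot))

  IsFilter : (A → Set) → Set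
  IsFilter F = (∃ λ a → F a) × (∀ a b → F a → a ≤ b → F b)
             × (∀ a b → F a → F b → F (a ∧ b))

  IsIdeal : (A → Set) → Set
  IsIdeal I = (∃ λ a → I a) × (∀ a b → I b → a ≤ b → I a)
            × (∀ a b → I a → I b → I (a ∨ b))

  IsTolerance : Rel A 0ℓ → Set
  IsTolerance γ = (∀ a → γ a a) × (∀ a b → γ a b → γ b a)
    × (∀ a b c d → γ a b → γ c d → γ (a ∨ c) (b ∨ d) × γ (a ∧ c) (b ∧ d))

IsLatIsoOnto : {A B : Set} (_∨₁_ _∧₁_ : Op₂ A) (_∨₂_ _∧₂_ : Op₂ B)
  (F : A → Set) (I : B → Set) (φ : A → B) → Set
IsLatIsoOnto {A} {B} _∨₁_ _∧₁_ _∨₂_ _∧₂_ F I φ =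
    (∀ a → F a → I (φ a))
  × (∀ b → I b → Σ A λ a → F a × φ a ≡ b)
  × (∀ a a' → F a → F a' → φ a ≡ φ a' → a ≡ a')
  × (∀ a a' → F a → F a' → φ (a ∨₁ a') ≡ (φ a ∨₂ φ a'))
  × (∀ a a' → F a → F a' → φ (a ∧₁ a') ≡ (φ a ∧₂ φ a'))

-- Modular connected systems.
-- The families F, I, φ are total, but only their values at pairs
-- x ≤_γ y are constrained / used (F x y = F_x^y ⊆ L_x, I x y = I_x^y ⊆ L_y,
-- φ x y = φ_x^y).

record ModularConnectedSystem : Set₁ where
  field
    S    : Set
    _≤_  : Rel S 0ℓ
    _∨_  : Op₂ S
    _∧_  : Op₂ S
    isLattice : IsLattice _≡_ _≤_ _∨_ _∧_
    γ    : Rel S 0ℓ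
    isTolerance : IsTolerance _≤_ _∨_ _∧_ γ
    L    : S → Set
    _≤L_ : ∀ {x} → Rel (L x) 0ℓ
    _∨L_ : ∀ {x} → Op₂ (L x)
    _∧L_ : ∀ {x} → Op₂ (L x)
    isLatticeL : ∀ x → IsLattice _≡_ (_≤L_ {x}) _∨L_ _∧L_
    F    : (x y : S) → L x → Set
    I    : (x y : S) → L y → Set
    φ    : (x y : S) → L x → L y

  _≤γ_ : Rel S 0ℓ
  x ≤γ y = x ≤ y × γ x y

  field
    MC1   : LFFC _≤_
    MC2   : ∀ x → FiniteCarrier {L x}
            × IsModular (_≤L_ {x}) _∨L_ _∧L_
            × IsComplemented (_≤L_ {x}) _∨L_ _∧L_
    MC3   : ∀ x y → x ≤γ y →
            IsFilter (_≤L_ {x}) _∨L_ _∧L_ (F x y)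
            × IsIdeal (_≤L_ {y}) _∨L_ _∧L_ (I x y)
            × IsLatIsoOnto _∨L_ _∧L_ _∨L_ _∧L_ (F x y) (I x y) (φ x y)
    MC4   : ∀ x → (∀ a → F x x a) × (∀ a → I x x a) × (∀ a → φ x x a ≡ a)
    MC5   : ∀ x y z → x ≤γ y → y ≤γ z →
            (∃ λ b → I x y b × F y z b) → γ x z
    MC6   : ∀ x z y → x ≤ z → z ≤ y → γ x y →
              (∀ a → F x y a ⇔ (F x z a × (I x z (φ x z a) × F z y (φ x z a))))
            × (∀ c → I x y c ⇔ (∃ λ b → (I x z b × F z y b) × φ z y b ≡ c))
            × (∀ a → F x y a → φ x y a ≡ φ z y (φ x z a))
    MC7   : ∀ x y → γ x y →
              (∀ c → I x (x ∨ y) c → I y (x ∨ y) c → I (x ∧ y) (x ∨ y) c)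
            × (∀ a → F (x ∧ y) x a → F (x ∧ y) y a → F (x ∧ y) (x ∨ y) a)
    MC8-1 : ∀ x y → Covers _≤_ x y → γ x y
    MC8-2 : ∀ x y → Covers _≤_ x y → ¬ (∀ a → F x y a) × ¬ (∀ b → I x y b)

  -- the sum: M = Σ S L with the relation ∼ ; L = M/∼
  M : Set
  M = Σ S L

  _∼_ : Rel M 0ℓ
  (x , a) ∼ (y , b) = γ x y × F x (x ∨ y) a × F y (x ∨ y) b
                      × φ x (x ∨ y) a ≡ φ y (x ∨ y) b

  -- Π_a for the element a ∈ L represented by p ∈ M:
  -- x ∈ Π_a  iff  a ∈ Λ_x  iff  a = π_x(b) for some b ∈ L_x
  Π : M → S → Set
  Π p x = ∃ λ (b : L x) → (x , b) ∼ p

-- Write a = π_y(c). Then x ∈ Π_a exactly when c can be transported down from y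
-- to x ∧ y (c ∈ I_{x∧y}^y) and up from y to x ∨ y (c ∈ F_y^{x∨y}); call these
-- sets of targets Down and Up. By MC6 and MC7, Up is closed under joins and
-- order-convex above y, and dually for Down. Climbing a cover inside Up strictly
-- shrinks the filter F_y^w of the finite lattice L_y (this is where MC8.2 enters),
-- so the climb stops at a cover-maximal element v, which by join-closure and the
-- finiteness of intervals is the greatest element of Up; dually Down has a least
-- element u. Hence Π_a = [u, v], which is finite by l.f.f.c.

{-# OPTIONS --safe #-}
module Submission where

open import Level using (0ℓ)
open import Algebra.Core using (Op₂)
open import Axiom.UniquenessOfIdentityProofs.WithK using (uip)
import Data.Fin.Properties as Fin
open import Data.List using (List; []; _∷_)
open import Data.List.Membership.Propositional using (_∈_; lose)
open import Data.List.Membership.Setoid.Properties using (index-injective)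
open import Data.List.Relation.Unary.Any using (here; there; index; any?; satisfied)
open import Data.Nat using (ℕ; suc; z≤n; s≤s) renaming (_≤_ to _≤ℕ_; _<_ to _<ℕ_)
open import Data.Nat.Induction using (<-wellFounded)
open import Data.Nat.Properties using (m≤n⇒m≤1+n)
open import Data.Product using (Σ; ∃; ∃₂; _×_; _,_; proj₁; proj₂)
import Data.Product as Product
open import Data.Product.Function.NonDependent.Propositional using (_×-⇔_)
open import Data.Sum using (_⊎_; inj₁; inj₂)
import Data.Sum as Sum
open import Data.Unit using (⊤; tt)
open import Function using (_∘_; flip; _⇔_; mk⇔; Equivalence)
open import Function.Construct.Composition using (_⇔-∘_)
open import Induction.WellFounded using (Acc; acc)
open import Relation.Binary.Core using (Rel)
import Relation.Binary.Construct.Flip.EqAndOrd as Flip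
import Relation.Binary.Construct.NonStrictToStrict as NonStrictToStrict
open import Relation.Binary.Definitions using (DecidableEquality) renaming (Decidable to Decidable₂)
open import Relation.Binary.Lattice using (Lattice; IsLattice)
open import Relation.Binary.Lattice.Definitions using (Supremum)
import Relation.Binary.Lattice.Properties.JoinSemilattice as JoinSemilatticeProperties
import Relation.Binary.Lattice.Properties.MeetSemilattice as MeetSemilatticeProperties
open import Relation.Binary.PropositionalEquality
  using (_≡_; refl; sym; trans; cong; cong₂; subst; subst₂; setoid; module ≡-Reasoning)
open import Relation.Binary.Structures using (IsPartialOrder)
open import Relation.Nullary using (¬_; Dec; yes; no; Irrelevant; contradiction)
open import Relation.Nullary.Decidable using (map′; _×-dec_; ¬?)
open import Relation.Unary using (Pred; Decidable; _⊆_)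
open import Defs hiding (_<_)

module _ {A : Set} where

  SubFinite-⊆ : {P Q : Pred A 0ℓ} → P ⊆ Q → SubFinite Q → SubFinite P
  SubFinite-⊆ P⊆Q (xs , complete) = xs , λ a pa → complete a (P⊆Q pa)

  SubFinite-∃? : {P : Pred A 0ℓ} → SubFinite P → Decidable P → Dec (∃ P)
  SubFinite-∃? (xs , complete) P? =
    map′ satisfied (λ (a , pa) → lose (complete a pa) pa) (any? P? xs)

  SubFinite-≟ : {P : Pred A 0ℓ} → (∀ {a} → Irrelevant (P a)) → SubFinite P →
                ∀ {a b} → P a → P b → Dec (a ≡ b)
  SubFinite-≟ irrelevant (xs , complete) {a} {b} pa pb =
    map′ (index-injective (setoid A) (complete a pa) (complete b pb))
         (λ { refl → cong (λ p → index (complete a p)) (irrelevant pa pb) })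
         (index (complete a pa) Fin.≟ index (complete b pb))

  FiniteCarrier-≟ : FiniteCarrier {A} → DecidableEquality A
  FiniteCarrier-≟ (xs , complete) a b =
    SubFinite-≟ {P = λ _ → ⊤} (λ { tt tt → refl }) (xs , λ a _ → complete a) tt tt

  count : {P : Pred A 0ℓ} → Decidable P → List A → ℕ
  count P? []       = 0
  count P? (x ∷ xs) with P? x
  ... | yes _ = suc (count P? xs)
  ... | no  _ = count P? xs

  module _ {P Q : Pred A 0ℓ} (P? : Decidable P) (Q? : Decidable Q) (Q⊆P : Q ⊆ P) where

    count-mono : ∀ xs → count Q? xs ≤ℕ count P? xs
    count-mono []       = z≤n
    count-mono (x ∷ xs) with P? x | Q? x
    ... | yes _ | yes _  = s≤s (count-mono xs)
    ... | yes _ | no  _  = m≤n⇒m≤1+n (count-mono xs)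
    ... | no ¬p | yes q  = contradiction (Q⊆P q) ¬p
    ... | no  _ | no  _  = count-mono xs

    count-< : ∀ {a} xs → a ∈ xs → P a → ¬ Q a → count Q? xs <ℕ count P? xs
    count-< (x ∷ xs) (here refl) p ¬q with P? x | Q? x
    ... | yes _ | yes q = contradiction q ¬q
    ... | yes _ | no  _ = s≤s (count-mono xs)
    ... | no ¬p | _     = contradiction p ¬p
    count-< (x ∷ xs) (there a∈xs) p ¬q with P? x | Q? x
    ... | yes _ | yes _  = s≤s (count-< xs a∈xs p ¬q)
    ... | yes _ | no  _  = m≤n⇒m≤1+n (count-< xs a∈xs p ¬q)
    ... | no ¬p | yes q  = contradiction (Q⊆P q) ¬p
    ... | no  _ | no  _  = count-< xs a∈xs p ¬q

module _ {A : Set} (Step : Rel A 0ℓ) (μ : A → ℕ)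
         (μ-decreasing : ∀ a b → Step a b → μ b <ℕ μ a)
         (step? : ∀ a → Dec (∃ (Step a))) where

  ∃-terminal : A → ∃ λ z → ∀ b → ¬ Step z b
  ∃-terminal a = descend a (<-wellFounded (μ a))
    where
      descend : ∀ a → Acc _<ℕ_ (μ a) → ∃ λ z → ∀ b → ¬ Step z b
      descend a (acc rs) with step? a
      ... | yes (b , ab) = descend b (rs (μ-decreasing a b ab))
      ... | no  stuck    = a , λ b ab → stuck (b , ab)

Covers-flip : {A : Set} {_≤_ : Rel A 0ℓ} {x y : A} → Covers (flip _≤_) x y → Covers _≤_ y x
Covers-flip ((y≤x , x≢y) , between) =
  (y≤x , λ y≡x → x≢y (sym y≡x)) , λ z y≤z z≤x → Sum.swap (between z z≤x y≤z)

module FiniteIntervals {A : Set} {_≤_ : Rel A 0ℓ}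
  (isPartialOrder : IsPartialOrder _≡_ _≤_)
  (_≟_ : DecidableEquality A) (_≤?_ : Decidable₂ _≤_)
  (intervals : ∀ x y → SubFinite (λ z → x ≤ z × z ≤ y)) where

  open IsPartialOrder isPartialOrder using (antisym) renaming (refl to ≤-refl; trans to ≤-trans)
  open NonStrictToStrict _≡_ _≤_ using (_<_; <⇒≤; <-decidable)

  _<?_ : Decidable₂ _<_
  _<?_ = <-decidable _≟_ _≤?_

  Between : A → A → Pred A 0ℓ
  Between x y z = x < z × z < y

  between? : ∀ x y → Dec (∃ (Between x y))
  between? x y = SubFinite-∃? (SubFinite-⊆ (λ (x<z , z<y) → <⇒≤ x<z , <⇒≤ z<y) (intervals x y))
                              (λ z → (x <? z) ×-dec (z <? y))

  nothing-between⇒Covers : ∀ {x y} → x < y → ¬ ∃ (Between x y) → Covers _≤_ x y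
  nothing-between⇒Covers {x} {y} x<y nothing = x<y , squeeze
    where
      squeeze : ∀ z → x ≤ z → z ≤ y → (z ≡ x) ⊎ (z ≡ y)
      squeeze z x≤z z≤y with z ≟ x | z ≟ y
      ... | yes z≡x | _       = inj₁ z≡x
      ... | no  _   | yes z≡y = inj₂ z≡y
      ... | no z≢x  | no z≢y  =
        contradiction (z , (x≤z , λ x≡z → z≢x (sym x≡z)) , (z≤y , z≢y)) nothing

  Covers⇒nothing-between : ∀ {x y} → Covers _≤_ x y → ¬ ∃ (Between x y)
  Covers⇒nothing-between (_ , squeeze) (z , (x≤z , x≢z) , (z≤y , z≢y))
    with squeeze z x≤z z≤y
  ... | inj₁ z≡x = x≢z (sym z≡x)
  ... | inj₂ z≡y = z≢y z≡y

  covers? : Decidable₂ (Covers _≤_)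
  covers? x y = map′ (λ (x<y , nothing) → nothing-between⇒Covers x<y nothing)
                     (λ x⋖y → proj₁ x⋖y , Covers⇒nothing-between x⋖y)
                     ((x <? y) ×-dec ¬? (between? x y))

  cover-below : ∀ {x y} → x < y → ∃ λ t → Covers _≤_ x t × t ≤ y
  cover-below {x} {y} x<y =
    let (t , x<t , t≤y) , terminal = ∃-terminal Step μ μ-decreasing step? (y , x<y , ≤-refl)
    in t , nothing-between⇒Covers x<t (λ (s , x<s , s<t) →
             terminal (s , x<s , ≤-trans (<⇒≤ s<t) t≤y) s<t) , t≤y
    where
      State : Set
      State = ∃ λ t → x < t × t ≤ y

      Step : Rel State 0ℓ
      Step (t , _) (s , _) = s < t

      zs : List A
      zs = proj₁ (intervals x y)

      μ : State → ℕ
      μ (t , _) = count (_≤? t) zs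

      μ-decreasing : ∀ a b → Step a b → μ b <ℕ μ a
      μ-decreasing (t , x<t , t≤y) (s , _) (s≤t , s≢t) =
        count-< (_≤? t) (_≤? s) (λ z≤s → ≤-trans z≤s s≤t) zs
                (proj₂ (intervals x y) t (<⇒≤ x<t , t≤y)) ≤-refl
                (λ t≤s → s≢t (antisym s≤t t≤s))

      step? : ∀ a → Dec (∃ (Step a))
      step? (t , x<t , t≤y) =
        map′ (λ (s , x<s , s<t) → (s , x<s , ≤-trans (<⇒≤ s<t) t≤y) , s<t)
             (λ ((s , x<s , _) , s<t) → s , x<s , s<t)
             (between? x t)

  cover-maximal⇒greatest : {_∨_ : Op₂ A} → Supremum _≤_ _∨_ → {X : Pred A 0ℓ} →
    (∀ {a b} → X a → X b → X (a ∨ b)) →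
    (∀ {a b c} → X a → X c → a ≤ b → b ≤ c → X b) →
    ∀ {v} → X v → (∀ t → Covers _≤_ v t → ¬ X t) → ∀ {z} → X z → z ≤ v
  cover-maximal⇒greatest {_∨_} sup ∨-closed convex {v} Xv maximal {z} Xz with z ≤? v
  ... | yes z≤v = z≤v
  ... | no  z≰v =
    let v≤v∨z , z≤v∨z , _ = sup v z
        v≢v∨z = λ v≡v∨z → z≰v (subst (z ≤_) (sym v≡v∨z) z≤v∨z)
        t , v⋖t , t≤v∨z = cover-below (v≤v∨z , v≢v∨z)
    in contradiction (convex Xv (∨-closed Xv Xz) (<⇒≤ (proj₁ v⋖t)) t≤v∨z) (maximal t v⋖t)

module LatticeProperties {A : Set} {_≤_ : Rel A 0ℓ} {_∨_ _∧_ : Op₂ A}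
  (isLattice : IsLattice _≡_ _≤_ _∨_ _∧_) where

  open IsLattice isLattice using (x≤x∨y; x∧y≤x)

  lattice : Lattice 0ℓ 0ℓ 0ℓ
  lattice = record { isLattice = isLattice }

  open JoinSemilatticeProperties (Lattice.joinSemilattice lattice) public
    using (∨-comm; ∨-idempotent; x≤y⇒x∨y≈y; ≈-dec⇒≤-dec)
  open MeetSemilatticeProperties (Lattice.meetSemilattice lattice) public
    using (∧-comm; ∧-idempotent; y≤x⇒x∧y≈y)

  y≤x⇒x∨y≡x : ∀ {x y} → y ≤ x → x ∨ y ≡ x
  y≤x⇒x∨y≡x y≤x = trans (∨-comm _ _) (x≤y⇒x∨y≈y y≤x)

  x≤y⇒x∧y≡x : ∀ {x y} → x ≤ y → x ∧ y ≡ x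
  x≤y⇒x∧y≡x x≤y = trans (∧-comm _ _) (y≤x⇒x∧y≈y x≤y)

  -- Interval membership is encoded by equations, which are proof-irrelevant
  -- (by K); so the position of z in the finite list covering the interval
  -- depends on z alone.
  ≟-from-intervals : (∀ x y → SubFinite (λ z → x ≤ z × z ≤ y)) → DecidableEquality A
  ≟-from-intervals intervals x y =
    SubFinite-≟ irrelevant (SubFinite-⊆ in-interval (intervals (x ∧ y) (x ∨ y)))
                (x≤y⇒x∨y≈y (x∧y≤x x y) , x≤y⇒x∨y≈y (x≤x∨y x y))
                (x≤y⇒x∨y≈y (x∧y≤y x y) , x≤y⇒x∨y≈y (y≤x∨y x y))
    where
      open IsLattice isLattice using (x∧y≤y; y≤x∨y)

      InInterval : Pred A 0ℓ
      InInterval z = ((x ∧ y) ∨ z) ≡ z × (z ∨ (x ∨ y)) ≡ (x ∨ y)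

      irrelevant : ∀ {z} → Irrelevant (InInterval z)
      irrelevant (p , q) (p′ , q′) = cong₂ _,_ (uip p p′) (uip q q′)

      in-interval : InInterval ⊆ (λ z → (x ∧ y) ≤ z × z ≤ (x ∨ y))
      in-interval {z} (p , q) = subst ((x ∧ y) ≤_) p (x≤x∨y _ z) , subst (z ≤_) q (x≤x∨y z _)

module ToleranceProperties {A : Set} {_≤_ : Rel A 0ℓ} {_∨_ _∧_ : Op₂ A}
  (isLattice : IsLattice _≡_ _≤_ _∨_ _∧_)
  {γ : Rel A 0ℓ} (isTolerance : IsTolerance _≤_ _∨_ _∧_ γ) where

  open LatticeProperties isLattice

  γ-refl : ∀ {x} → γ x x
  γ-refl = proj₁ isTolerance _

  γ-sym : ∀ {x y} → γ x y → γ y x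
  γ-sym = proj₁ (proj₂ isTolerance) _ _

  γ-∨ : ∀ {a b c d} → γ a b → γ c d → γ (a ∨ c) (b ∨ d)
  γ-∨ γab γcd = proj₁ (proj₂ (proj₂ isTolerance) _ _ _ _ γab γcd)

  γ-∧ : ∀ {a b c d} → γ a b → γ c d → γ (a ∧ c) (b ∧ d)
  γ-∧ γab γcd = proj₂ (proj₂ (proj₂ isTolerance) _ _ _ _ γab γcd)

  γ-within : ∀ {a b x y} → γ a b → a ≤ x → x ≤ b → a ≤ y → y ≤ b → γ x y
  γ-within {a} {b} {x} {y} γab a≤x x≤b a≤y y≤b =
    subst₂ γ (y≤x⇒x∨y≡x a≤x) (x≤y⇒x∨y≈y a≤y)
      (γ-∨ (γ-sym (γ-inf a≤x x≤b)) (γ-inf a≤y y≤b))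
    where
      γ-inf : ∀ {z} → a ≤ z → z ≤ b → γ a z
      γ-inf a≤z z≤b = subst₂ γ (x≤y⇒x∧y≡x a≤z) (y≤x⇒x∧y≈y z≤b) (γ-∧ γab γ-refl)

  γ-meet-join : ∀ {x y} → γ x y → γ (x ∧ y) (x ∨ y)
  γ-meet-join {x} {y} γxy =
    subst₂ γ refl (∧-idempotent (x ∨ y))
      (γ-∧ (subst₂ γ (∨-idempotent x) refl (γ-∨ γ-refl γxy))
           (subst₂ γ (∨-idempotent y) refl (γ-∨ (γ-sym γxy) γ-refl)))

  γ-∨-closed : ∀ {y a b} → γ y a → γ y b → γ y (a ∨ b)
  γ-∨-closed γya γyb = subst₂ γ (∨-idempotent _) refl (γ-∨ γya γyb)

  γ-∧-closed : ∀ {y a b} → γ a y → γ b y → γ (a ∧ b) y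
  γ-∧-closed γay γby = subst₂ γ refl (∧-idempotent _) (γ-∧ γay γby)

module FilterIdealIso {A B : Set}
  {_≤₁_ : Rel A 0ℓ} {_∨₁_ _∧₁_ : Op₂ A} {_≤₂_ : Rel B 0ℓ} {_∨₂_ _∧₂_ : Op₂ B}
  (isLattice₁ : IsLattice _≡_ _≤₁_ _∨₁_ _∧₁_)
  (isLattice₂ : IsLattice _≡_ _≤₂_ _∨₂_ _∧₂_)
  {F : Pred A 0ℓ} {I : Pred B 0ℓ} {φ : A → B}
  (isFilter : IsFilter _≤₁_ _∨₁_ _∧₁_ F) (isIdeal : IsIdeal _≤₂_ _∨₂_ _∧₂_ I)
  (isIso : IsLatIsoOnto _∨₁_ _∧₁_ _∨₂_ _∧₂_ F I φ) where

  private
    module L₁ = IsLattice isLattice₁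
    module L₂ = IsLattice isLattice₂

  F-up : ∀ {a b} → F a → a ≤₁ b → F b
  F-up = proj₁ (proj₂ isFilter) _ _

  F-∧ : ∀ {a b} → F a → F b → F (a ∧₁ b)
  F-∧ = proj₂ (proj₂ isFilter) _ _

  I-down : ∀ {a b} → I b → a ≤₂ b → I a
  I-down = proj₁ (proj₂ isIdeal) _ _

  φ-into : ∀ {a} → F a → I (φ a)
  φ-into = proj₁ isIso _

  φ-onto : ∀ {b} → I b → ∃ λ a → F a × φ a ≡ b
  φ-onto = proj₁ (proj₂ isIso) _

  φ-injective : ∀ {a a′} → F a → F a′ → φ a ≡ φ a′ → a ≡ a′
  φ-injective = proj₁ (proj₂ (proj₂ isIso)) _ _

  φ-∨ : ∀ {a a′} → F a → F a′ → φ (a ∨₁ a′) ≡ φ a ∨₂ φ a′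
  φ-∨ = proj₁ (proj₂ (proj₂ (proj₂ isIso))) _ _

  φ-∧ : ∀ {a a′} → F a → F a′ → φ (a ∧₁ a′) ≡ φ a ∧₂ φ a′
  φ-∧ = proj₂ (proj₂ (proj₂ (proj₂ isIso))) _ _

  module _ {⊤ : A} (⊤-max : ∀ a → a ≤₁ ⊤) where

    F-⊤ : F ⊤
    F-⊤ = let a , Fa = proj₁ isFilter in F-up Fa (⊤-max a)

    ideal-principal : ∀ b → I b ⇔ b ≤₂ φ ⊤
    ideal-principal b = mk⇔ to (λ b≤φ⊤ → I-down (φ-into F-⊤) b≤φ⊤)
      where
        to : I b → b ≤₂ φ ⊤
        to Ib with φ-onto Ib
        ... | a , Fa , refl = subst (φ a ≤₂_) φ[a∨⊤]≡φ⊤ (L₂.x≤x∨y (φ a) (φ ⊤))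
          where
            φ[a∨⊤]≡φ⊤ : φ a ∨₂ φ ⊤ ≡ φ ⊤
            φ[a∨⊤]≡φ⊤ = trans (sym (φ-∨ Fa F-⊤))
                              (cong φ (LatticeProperties.x≤y⇒x∨y≈y isLattice₁ (⊤-max a)))

    I? : Decidable₂ _≤₂_ → Decidable I
    I? _≤?_ b =
      map′ (Equivalence.from (ideal-principal b)) (Equivalence.to (ideal-principal b)) (b ≤? φ ⊤)

  module _ {⊥ : B} (⊥-min : ∀ b → ⊥ ≤₂ b) where

    I-⊥ : I ⊥
    I-⊥ = let b , Ib = proj₁ isIdeal in I-down Ib (⊥-min b)

    filter-principal : ∃ λ g → ∀ a → F a ⇔ g ≤₁ a
    filter-principal with φ-onto I-⊥
    ... | g , Fg , φg≡⊥ = g , λ a → mk⇔ (to a) (F-up Fg)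
      where
        open ≡-Reasoning
        to : ∀ a → F a → g ≤₁ a
        to a Fa = subst (_≤₁ a) g∧a≡g (L₁.x∧y≤y g a)
          where
            g∧a≡g : g ∧₁ a ≡ g
            g∧a≡g = φ-injective (F-∧ Fg Fa) Fg (begin
              φ (g ∧₁ a)   ≡⟨ φ-∧ Fg Fa ⟩
              φ g ∧₂ φ a   ≡⟨ cong (_∧₂ φ a) φg≡⊥ ⟩
              ⊥ ∧₂ φ a     ≡⟨ LatticeProperties.x≤y⇒x∧y≡x isLattice₂ (⊥-min (φ a)) ⟩
              ⊥            ≡⟨ sym φg≡⊥ ⟩
              φ g          ∎)

    F? : Decidable₂ _≤₁_ → Decidable F
    F? _≤?_ a = let g , F⇔ = filter-principal in
      map′ (Equivalence.from (F⇔ a)) (Equivalence.to (F⇔ a)) (g ≤? a)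

module ModularConnectedSystemProperties (Sys : ModularConnectedSystem) where

  open ModularConnectedSystem Sys
  open IsLattice isLattice
    using (x≤x∨y; y≤x∨y; x∧y≤x; x∧y≤y; ∨-least; ∧-greatest; supremum; infimum)
    renaming (refl to ≤-refl; trans to ≤-trans; isPartialOrder to ≤-isPartialOrder)
  open ToleranceProperties isLattice isTolerance

  intervals : ∀ x y → SubFinite (λ z → x ≤ z × z ≤ y)
  intervals = proj₁ MC1

  _≟_ : DecidableEquality S
  _≟_ = LatticeProperties.≟-from-intervals isLattice intervals

  _≤?_ : Decidable₂ _≤_
  _≤?_ = LatticeProperties.≈-dec⇒≤-dec isLattice _≟_

  open FiniteIntervals ≤-isPartialOrder _≟_ _≤?_ intervals using (covers?; cover-maximal⇒greatest)
  module Dual = FiniteIntervals (Flip.isPartialOrder ≤-isPartialOrder) _≟_ (flip _≤?_)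
                                (λ x y → SubFinite-⊆ Product.swap (intervals y x))

  module _ (x : S) where
    private
      complemented : IsComplemented (_≤L_ {x}) _∨L_ _∧L_
      complemented = proj₂ (proj₂ (MC2 x))

    ⊥L : L x
    ⊥L = proj₁ complemented

    ⊤L : L x
    ⊤L = proj₁ (proj₂ complemented)

    ⊥L-min : ∀ a → ⊥L ≤L a
    ⊥L-min = proj₁ (proj₂ (proj₂ complemented))

    ⊤L-max : ∀ a → a ≤L ⊤L
    ⊤L-max = proj₁ (proj₂ (proj₂ (proj₂ complemented)))

    enumL : List (L x)
    enumL = proj₁ (proj₁ (MC2 x))

    enumL-complete : ∀ a → a ∈ enumL
    enumL-complete = proj₂ (proj₁ (MC2 x))

    ≤L? : Decidable₂ (_≤L_ {x})
    ≤L? = LatticeProperties.≈-dec⇒≤-dec (isLatticeL x) (FiniteCarrier-≟ (proj₁ (MC2 x)))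

  module Link {x y : S} (x≤γy : x ≤γ y) where
    open FilterIdealIso (isLatticeL x) (isLatticeL y)
           (proj₁ (MC3 x y x≤γy)) (proj₁ (proj₂ (MC3 x y x≤γy))) (proj₂ (proj₂ (MC3 x y x≤γy))) public

    F-top : F x y (⊤L x)
    F-top = F-⊤ (⊤L-max x)

    I-bot : I x y (⊥L y)
    I-bot = I-⊥ (⊥L-min y)

    F-dec : Decidable (F x y)
    F-dec = F? (⊥L-min y) (≤L? x)

    I-dec : Decidable (I x y)
    I-dec = I? (⊤L-max x) (≤L? y)

  module _ {x z y : S} (x≤z : x ≤ z) (z≤y : z ≤ y) (γxy : γ x y) where

    F-split : ∀ {a} → F x y a → F x z a × I x z (φ x z a) × F z y (φ x z a)
    F-split = Equivalence.to (proj₁ (MC6 x z y x≤z z≤y γxy) _)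

    F-glue : ∀ {a} → F x z a × I x z (φ x z a) × F z y (φ x z a) → F x y a
    F-glue = Equivalence.from (proj₁ (MC6 x z y x≤z z≤y γxy) _)

    I-split : ∀ {c} → I x y c → ∃ λ b → (I x z b × F z y b) × φ z y b ≡ c
    I-split = Equivalence.to (proj₁ (proj₂ (MC6 x z y x≤z z≤y γxy)) _)

    I-glue : ∀ {c} → (∃ λ b → (I x z b × F z y b) × φ z y b ≡ c) → I x y c
    I-glue = Equivalence.from (proj₁ (proj₂ (MC6 x z y x≤z z≤y γxy)) _)

    φ-factor : ∀ {a} → F x y a → φ x y a ≡ φ z y (φ x z a)
    φ-factor = proj₂ (proj₂ (MC6 x z y x≤z z≤y γxy)) _

  module Transport (y : S) (c : L y) where

    Up : Pred S 0ℓ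
    Up w = y ≤γ w × F y w c

    Down : Pred S 0ℓ
    Down w = w ≤γ y × I w y c

    Up-y : Up y
    Up-y = (≤-refl , γ-refl) , proj₁ (MC4 y) c

    Down-y : Down y
    Down-y = (≤-refl , γ-refl) , proj₁ (proj₂ (MC4 y)) c

    Up-convex : ∀ {a b} → Up b → y ≤ a → a ≤ b → Up a
    Up-convex ((y≤b , γyb) , Fc) y≤a a≤b =
      (y≤a , γ-within γyb ≤-refl y≤b y≤a a≤b) , proj₁ (F-split y≤a a≤b γyb Fc)

    Down-convex : ∀ {a b} → Down a → a ≤ b → b ≤ y → Down b
    Down-convex ((a≤y , γay) , Ic) a≤b b≤y =
      let e , (_ , Fe) , φe≡c = I-split a≤b b≤y γay Ic
          b≤γy = b≤y , γ-within γay a≤b b≤y a≤y ≤-refl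
      in b≤γy , subst (I _ y) φe≡c (Link.φ-into b≤γy Fe)

    Up-∨ : ∀ {a b} → Up a → Up b → Up (a ∨ b)
    Up-∨ {a} {b} ((y≤a , γya) , Fa) ((y≤b , γyb) , Fb) =
      let γya∨b = γ-∨-closed γya γyb
          γab = γ-within γya∨b y≤a (x≤x∨y a b) y≤b (y≤x∨y a b)
          y≤a∧b = ∧-greatest y≤a y≤b
          F-y-a∧b , I-y-a∧b , F-a∧b-a = F-split y≤a∧b (x∧y≤x a b) γya Fa
          _       , _       , F-a∧b-b = F-split y≤a∧b (x∧y≤y a b) γyb Fb
          F-a∧b-a∨b = proj₂ (MC7 a b γab) _ F-a∧b-a F-a∧b-b
      in (≤-trans y≤a (x≤x∨y a b) , γya∨b) ,
         F-glue y≤a∧b (≤-trans (x∧y≤x a b) (x≤x∨y a b)) γya∨b (F-y-a∧b , I-y-a∧b , F-a∧b-a∨b)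

    Down-∧ : ∀ {a b} → Down a → Down b → Down (a ∧ b)
    Down-∧ {a} {b} ((a≤y , γay) , Ia) ((b≤y , γby) , Ib) =
      let a∧b≤y = ≤-trans (x∧y≤x a b) a≤y
          a∨b≤y = ∨-least a≤y b≤y
          a∧b≤a∨b = ≤-trans (x∧y≤x a b) (x≤x∨y a b)
          γa∧by = γ-∧-closed γay γby
          γab = γ-within γa∧by (x∧y≤x a b) a≤y (x∧y≤y a b) b≤y
          γa∨by = γ-within γa∧by a∧b≤a∨b a∨b≤y a∧b≤y ≤-refl
          e  , (I-a-a∨b , Fe)  , φe≡c  = I-split (x≤x∨y a b) a∨b≤y γay Ia
          e′ , (I-b-a∨b , Fe′) , φe′≡c = I-split (y≤x∨y a b) a∨b≤y γby Ib
          e′≡e = Link.φ-injective (a∨b≤y , γa∨by) Fe′ Fe (trans φe′≡c (sym φe≡c))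
          I-a∧b-a∨b = proj₁ (MC7 a b γab) e I-a-a∨b (subst (I b (a ∨ b)) e′≡e I-b-a∨b)
      in (a∧b≤y , γa∧by) , I-glue a∧b≤a∨b a∨b≤y γa∧by (e , (I-a∧b-a∨b , Fe) , φe≡c)

    Π⇔Down×Up : ∀ x → Π (y , c) x ⇔ (Down (x ∧ y) × Up (x ∨ y))
    Π⇔Down×Up x = mk⇔ to from
      where
        m≤j : (x ∧ y) ≤ (x ∨ y)
        m≤j = ≤-trans (x∧y≤y x y) (y≤x∨y x y)

        to : Π (y , c) x → Down (x ∧ y) × Up (x ∨ y)
        to (b , γxy , Fb , Fc , φb≡φc) =
          let γmj = γ-meet-join γxy
              y≤γj = y≤x∨y x y , γ-within γmj (x∧y≤y x y) (y≤x∨y x y) m≤j ≤-refl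
              x≤γj = x≤x∨y x y , γ-within γmj (x∧y≤x x y) (x≤x∨y x y) m≤j ≤-refl
              m≤γy = x∧y≤y x y , γ-within γmj ≤-refl m≤j (x∧y≤y x y) (y≤x∨y x y)
              I-m-j = proj₁ (MC7 x y γxy) _
                        (subst (I x (x ∨ y)) φb≡φc (Link.φ-into x≤γj Fb)) (Link.φ-into y≤γj Fc)
              e , Fe , φe≡φc = Link.φ-onto (m≤j , γmj) I-m-j
              _ , I-m-y , F-y-j = F-split (x∧y≤y x y) (y≤x∨y x y) γmj Fe
              φe↓≡c = Link.φ-injective y≤γj F-y-j Fc
                        (trans (sym (φ-factor (x∧y≤y x y) (y≤x∨y x y) γmj Fe)) φe≡φc)
          in (m≤γy , subst (I (x ∧ y) y) φe↓≡c I-m-y) , (y≤γj , Fc)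

        from : Down (x ∧ y) × Up (x ∨ y) → Π (y , c) x
        from (((m≤y , γmy) , Ic) , ((y≤j , γyj) , Fc)) =
          let e , Fe , φe≡c = Link.φ-onto (m≤y , γmy) Ic
              γmj = MC5 (x ∧ y) y (x ∨ y) (m≤y , γmy) (y≤j , γyj) (c , Ic , Fc)
              F-m-j = F-glue m≤y y≤j γmj
                        (Fe , subst (I (x ∧ y) y) (sym φe≡c) Ic , subst (F y (x ∨ y)) (sym φe≡c) Fc)
              _ , _ , F-x-j = F-split (x∧y≤x x y) (x≤x∨y x y) γmj F-m-j
              γxy = γ-within γmj (x∧y≤x x y) (x≤x∨y x y) m≤y y≤j
          in φ (x ∧ y) x e , γxy , F-x-j , Fc , (begin
               φ x (x ∨ y) (φ (x ∧ y) x e)   ≡⟨ sym (φ-factor (x∧y≤x x y) (x≤x∨y x y) γmj F-m-j) ⟩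
               φ (x ∧ y) (x ∨ y) e           ≡⟨ φ-factor m≤y y≤j γmj F-m-j ⟩
               φ y (x ∨ y) (φ (x ∧ y) y e)   ≡⟨ cong (φ y (x ∨ y)) φe≡c ⟩
               φ y (x ∨ y) c                 ∎)
          where open ≡-Reasoning

    Up-across-cover : ∀ {w t} → Up w → Covers _≤_ w t → Up t ⇔ F w t (φ y w c)
    Up-across-cover {w} {t} ((y≤w , γyw) , Fc) w⋖t = mk⇔ to from
      where
        w≤t : w ≤ t
        w≤t = proj₁ (proj₁ w⋖t)

        to : Up t → F w t (φ y w c)
        to ((_ , γyt) , F-y-t) = proj₂ (proj₂ (F-split y≤w w≤t γyt F-y-t))

        from : F w t (φ y w c) → Up t
        from F-w-t =
          let I-y-w = Link.φ-into (y≤w , γyw) Fc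
              γyt = MC5 y w t (y≤w , γyw) (w≤t , MC8-1 w t w⋖t) (_ , I-y-w , F-w-t)
          in (≤-trans y≤w w≤t , γyt) , F-glue y≤w w≤t γyt (Fc , I-y-w , F-w-t)

    Up-measure : Σ S Up → ℕ
    Up-measure (w , y≤γw , _) = count (Link.F-dec y≤γw) (enumL y)

    Up-measure-decreasing : ∀ (w t : Σ S Up) → Covers _≤_ (proj₁ w) (proj₁ t) →
                            Up-measure t <ℕ Up-measure w
    Up-measure-decreasing (w , y≤γw@(y≤w , _) , _) (t , y≤γt@(_ , γyt) , _) w⋖t =
      let a , Fa , φa≡⊥ = Link.φ-onto y≤γw (Link.I-bot y≤γw) in
      count-< (Link.F-dec y≤γw) (Link.F-dec y≤γt) (λ Fb → proj₁ (F-split y≤w w≤t γyt Fb))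
              (enumL y) (enumL-complete y a) Fa (¬F-y-t φa≡⊥)
      where
        w≤t : w ≤ t
        w≤t = proj₁ (proj₁ w⋖t)

        ¬F-y-t : ∀ {a} → φ y w a ≡ ⊥L w → ¬ F y t a
        ¬F-y-t φa≡⊥ F-y-t = proj₁ (MC8-2 w t w⋖t) λ b →
          Link.F-up (w≤t , MC8-1 w t w⋖t)
            (subst (F w t) φa≡⊥ (proj₂ (proj₂ (F-split y≤w w≤t γyt F-y-t)))) (⊥L-min w b)

    Up-cover? : ∀ {w} → Up w → ∀ t → Dec (Covers _≤_ w t × Up t)
    Up-cover? {w} Up-w t with covers? w t
    ... | no ¬w⋖t = no (¬w⋖t ∘ proj₁)
    ... | yes w⋖t =
      map′ (λ F-w-t → w⋖t , Equivalence.from (Up-across-cover Up-w w⋖t) F-w-t)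
           (λ (_ , Up-t) → Equivalence.to (Up-across-cover Up-w w⋖t) Up-t)
           (Link.F-dec (proj₁ (proj₁ w⋖t) , MC8-1 w t w⋖t) (φ y w c))

    Up-greatest : ∃ λ v → Up v × ∀ {z} → Up z → z ≤ v
    Up-greatest =
      let (v , Up-v) , maximal = ∃-terminal Step Up-measure Up-measure-decreasing step? (y , Up-y)
      in v , Up-v , cover-maximal⇒greatest supremum Up-∨
                      (λ (y≤γa , _) Up-c a≤b b≤c → Up-convex Up-c (≤-trans (proj₁ y≤γa) a≤b) b≤c)
                      Up-v (λ t v⋖t Up-t → maximal (t , Up-t) v⋖t)
      where
        Step : Rel (Σ S Up) 0ℓ
        Step (w , _) (t , _) = Covers _≤_ w t

        step? : ∀ w → Dec (∃ (Step w))
        step? (w , Up-w) =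
          map′ (λ (t , w⋖t , Up-t) → (t , Up-t) , w⋖t)
               (λ ((t , Up-t) , w⋖t) → t , w⋖t , Up-t)
               (SubFinite-∃? (SubFinite-⊆ proj₁ (proj₁ (proj₂ MC1) w)) (Up-cover? Up-w))

    Down-across-cover : ∀ {w t e} → w ≤γ y → F w y e → φ w y e ≡ c →
                        Covers _≤_ t w → Down t ⇔ I t w e
    Down-across-cover {w} {t} {e} w≤γy@(w≤y , _) Fe φe≡c t⋖w = mk⇔ to from
      where
        t≤w : t ≤ w
        t≤w = proj₁ (proj₁ t⋖w)

        to : Down t → I t w e
        to ((_ , γty) , I-t-y) =
          let e′ , (I-t-w , Fe′) , φe′≡c = I-split t≤w w≤y γty I-t-y
          in subst (I t w) (Link.φ-injective w≤γy Fe′ Fe (trans φe′≡c (sym φe≡c))) I-t-w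

        from : I t w e → Down t
        from I-t-w =
          let γty = MC5 t w y (t≤w , MC8-1 t w t⋖w) w≤γy (e , I-t-w , Fe)
          in (≤-trans t≤w w≤y , γty) , I-glue t≤w w≤y γty (e , (I-t-w , Fe) , φe≡c)

    Down-measure : Σ S Down → ℕ
    Down-measure (w , w≤γy , _) = count (Link.I-dec w≤γy) (enumL y)

    Down-measure-decreasing : ∀ (w t : Σ S Down) → Covers _≤_ (proj₁ t) (proj₁ w) →
                              Down-measure t <ℕ Down-measure w
    Down-measure-decreasing (w , w≤γy@(w≤y , _) , _) (t , t≤γy@(_ , γty) , _) t⋖w =
      count-< (Link.I-dec w≤γy) (Link.I-dec t≤γy) I-t-y⊆I-w-y
              (enumL y) (enumL-complete y (φ w y (⊤L w))) (Link.φ-into w≤γy (Link.F-top w≤γy)) ¬I-t-y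
      where
        t≤w : t ≤ w
        t≤w = proj₁ (proj₁ t⋖w)

        I-t-y⊆I-w-y : I t y ⊆ I w y
        I-t-y⊆I-w-y I-t-y =
          let e , (_ , Fe) , φe≡ = I-split t≤w w≤y γty I-t-y
          in subst (I w y) φe≡ (Link.φ-into w≤γy Fe)

        ¬I-t-y : ¬ I t y (φ w y (⊤L w))
        ¬I-t-y I-t-y =
          let e , (I-t-w , Fe) , φe≡φ⊤ = I-split t≤w w≤y γty I-t-y
              e≡⊤ = Link.φ-injective w≤γy Fe (Link.F-top w≤γy) φe≡φ⊤
          in proj₂ (MC8-2 t w t⋖w) λ b →
               Link.I-down (t≤w , MC8-1 t w t⋖w) (subst (I t w) e≡⊤ I-t-w) (⊤L-max w b)

    Down-cover? : ∀ {w} → Down w → ∀ t → Dec (Covers _≤_ t w × Down t)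
    Down-cover? {w} (w≤γy , Ic) t with covers? t w
    ... | no ¬t⋖w = no (¬t⋖w ∘ proj₁)
    ... | yes t⋖w =
      let e , Fe , φe≡c = Link.φ-onto w≤γy Ic
          Down-t⇔I = Down-across-cover w≤γy Fe φe≡c t⋖w
      in map′ (λ I-t-w → t⋖w , Equivalence.from Down-t⇔I I-t-w)
              (λ (_ , Down-t) → Equivalence.to Down-t⇔I Down-t)
              (Link.I-dec (proj₁ (proj₁ t⋖w) , MC8-1 t w t⋖w) e)

    Down-least : ∃ λ u → Down u × ∀ {z} → Down z → u ≤ z
    Down-least =
      let (u , Down-u) , minimal = ∃-terminal Step Down-measure Down-measure-decreasing step? (y , Down-y)
      in u , Down-u , Dual.cover-maximal⇒greatest infimum Down-∧
                        (λ ((a≤y , _) , _) Down-c b≤a c≤b → Down-convex Down-c c≤b (≤-trans b≤a a≤y))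
                        Down-u (λ t u⋖t Down-t → minimal (t , Down-t) (Covers-flip u⋖t))
      where
        Step : Rel (Σ S Down) 0ℓ
        Step (w , _) (t , _) = Covers _≤_ t w

        step? : ∀ w → Dec (∃ (Step w))
        step? (w , Down-w) =
          map′ (λ (t , t⋖w , Down-t) → (t , Down-t) , t⋖w)
               (λ ((t , Down-t) , t⋖w) → t , t⋖w , Down-t)
               (SubFinite-∃? (SubFinite-⊆ proj₁ (proj₂ (proj₂ MC1) w)) (Down-cover? Down-w))

    Up⇔≤ : ∀ {v} → Up v → (∀ {z} → Up z → z ≤ v) → ∀ x → Up (x ∨ y) ⇔ x ≤ v
    Up⇔≤ Up-v greatest x =
      mk⇔ (λ Up-x∨y → ≤-trans (x≤x∨y x y) (greatest Up-x∨y))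
          (λ x≤v → Up-convex Up-v (y≤x∨y x y) (∨-least x≤v (proj₁ (proj₁ Up-v))))

    Down⇔≥ : ∀ {u} → Down u → (∀ {z} → Down z → u ≤ z) → ∀ x → Down (x ∧ y) ⇔ u ≤ x
    Down⇔≥ Down-u least x =
      mk⇔ (λ Down-x∧y → ≤-trans (least Down-x∧y) (x∧y≤x x y))
          (λ u≤x → Down-convex Down-u (∧-greatest u≤x (proj₁ (proj₁ Down-u))) (x∧y≤y x y))

    Π-interval : ∃₂ λ u v → u ≤ v × ∀ x → Π (y , c) x ⇔ (u ≤ x × x ≤ v)
    Π-interval =
      let u , Down-u , least = Down-least
          v , Up-v , greatest = Up-greatest
      in u , v , ≤-trans (proj₁ (proj₁ Down-u)) (proj₁ (proj₁ Up-v)) ,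
         λ x → (Down⇔≥ Down-u least x ×-⇔ Up⇔≤ Up-v greatest x) ⇔-∘ Π⇔Down×Up x

lemma4p40p1 : (Sys : ModularConnectedSystem) →
    let open ModularConnectedSystem Sys in
    (p : M) →
    Σ S λ u → Σ S λ v → u ≤ v
      × (∀ x → Π p x ⇔ (u ≤ x × x ≤ v))
      × SubFinite (Π p)
lemma4p40p1 Sys (y , c) =
  let u , v , u≤v , Π⇔ = Π-interval in
  u , v , u≤v , Π⇔ , SubFinite-⊆ (Equivalence.to (Π⇔ _)) (intervals u v)
  where
    open ModularConnectedSystemProperties Sys
    open Transport y c
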